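{- For every non-negative integer $k$ there exists a Boolean function $f:\{0,1\}^n\to\{0,1\}$ on $n=(2k+1)^2$ variables such that $s(f)=2k+1$ and $bs(f)=(2k+1)(k+1)$.
   Context: For $w\in\{0,1\}^n$ and $S\subseteq\{1,\dots,n\}$, $w^S$ denotes $w$ with all bits indexed by $S$ flipped. The sensitivity of $f$ on $w$ is $s(f,w)=|\{i: f(w)\neq f(w^{\{i\}})\}|$, and $s(f)=\max_w s(f,w)$. The block sensitivity $bs(f,w)$ is the maximum number $k$ of pairwise disjoint subsets $B_1,\dots,B_k$ of $\{1,\dots,n\}$ such that $f(w)\neq f(w^{B_i})$ for each $i$, and $bs(f)=\max_w bs(f,w)$. -}

module Defs where

open import Data.Nat using (ℕ; zero; suc; _+_; _≤_)
open import Data.Bool using (Bool; true; false; not; if_then_else_; _xor_)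
open import Data.Fin using (Fin; _≟_)
open import Data.List using (List; length; filterᵇ)
open import Data.List using (allFin) public
open import Data.Product using (Σ; ∃; _×_)
open import Relation.Nullary using (¬_)
open import Relation.Nullary.Decidable using (⌊_⌋)
open import Relation.Binary.PropositionalEquality using (_≡_; _≢_)

-- Inputs w ∈ {0,1}^n are functions Fin n → Bool (false = 0, true = 1).
Word : ℕ → Set
Word n = Fin n → Bool

Subset′ : ℕ → Set
Subset′ n = Fin n → Bool

flipSet : {n : ℕ} → Word n → Subset′ n → Word n
flipSet w S j = if S j then not (w j) else w j

singleton : {n : ℕ} → Fin n → Subset′ n
singleton i j = ⌊ i ≟ j ⌋

flipBit : {n : ℕ} → Word n → Fin n → Word n
flipBit w i = flipSet w (singleton i)

BoolFun : ℕ → Set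
BoolFun n = Word n → Bool

sensAt : {n : ℕ} → BoolFun n → Word n → ℕ
sensAt f w = length (filterᵇ (λ i → f w xor f (flipBit w i)) (allFin _))

SensitivityIs : {n : ℕ} → BoolFun n → ℕ → Set
SensitivityIs f m = (∃ λ w → sensAt f w ≡ m) × (∀ w → sensAt f w ≤ m)

SensitiveBlocks : {n : ℕ} → BoolFun n → Word n → ℕ → Set
SensitiveBlocks {n} f w k =
  Σ (Fin k → Subset′ n) λ B →
    (∀ a b → a ≢ b → ∀ x → B a x ≡ true → B b x ≡ false)
    × (∀ a → f w ≢ f (flipSet w (B a)))

BlockSensitivityIs : {n : ℕ} → BoolFun n → ℕ → Set
BlockSensitivityIs f m =
  (∃ λ w → SensitiveBlocks f w m) × (∀ w k → SensitiveBlocks f w k → k ≤ m)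

module Submission where

-- Split the 2k+1 positions of a block into k pairs and one loner, and let
-- g(y) = 1 iff y is the indicator vector of exactly one of these k+1 classes;
-- f is the OR of 2k+1 copies of g on disjoint blocks.  At the all-zero input
-- the k+1 classes of every block are disjoint sensitive blocks, giving
-- bs(f) ≥ (2k+1)(k+1), while flipping the loner of any block is sensitive,
-- giving s(f) ≥ 2k+1.  Conversely, at a 1-input every sensitive set must meet
-- an accepting block, so there are at most 2k+1 of them; at a 0-input a
-- sensitive set turns some block into some class indicator, and two disjoint
-- sets cannot do this for the same block and class, so there are at most
-- (2k+1)(k+1).  Finally, distinct class indicators differ in at least three
-- positions, so no 0-input of g has two sensitive bits: at a 0-input of f each
-- block contributes at most one sensitive bit.

open import Defs
open import Data.Nat using (ℕ; _+_; _*_; _≤_; _⊔_)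
open import Data.Nat.Properties using (+-comm; ≤-antisym; ≤-trans; ≤⇒≯; ⊔-idem; m≤m⊔n; m≤n⊔m; m≤n⇒m⊔n≡n; m≤m*n)
open import Data.Bool using (Bool; true; false; not; _xor_; _∧_; T; if_then_else_)
open import Data.Bool.Properties using (¬-not; not-¬; T-≡) renaming (_≟_ to _≟ᵇ_)
open import Data.Fin using (Fin; zero; suc; _≟_; combine; remQuot; splitAt; join; _↑ˡ_; _↑ʳ_)
open import Data.Fin.Properties
  using (any?; all?; ¬∀⟶∃¬; injective⇒≤; remQuot-combine; combine-remQuot; combine-injective;
         combine-injectiveˡ; combine-injectiveʳ; ↑ˡ-injective; splitAt-↑ˡ; splitAt-↑ʳ; join-splitAt)
open import Data.List using (List; _∷_; length; filterᵇ; lookup)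
open import Data.List.Relation.Unary.All as All using ()
open import Data.List.Relation.Unary.AllPairs using (_∷_)
open import Data.List.Relation.Unary.Any using (index)
open import Data.List.Relation.Unary.Any.Properties using (lookup-index)
open import Data.List.Relation.Unary.Unique.Propositional using (Unique)
open import Data.List.Relation.Unary.Unique.Propositional.Properties using (allFin⁺; filter⁺)
open import Data.List.Membership.Propositional using (_∈_)
open import Data.List.Membership.Propositional.Properties using (∈-lookup; ∈-filter⁺; ∈-filter⁻; ∈-allFin)
open import Data.Product using (Σ; ∃; _×_; _,_; proj₁; proj₂; uncurry)
open import Data.Sum using (_⊎_; inj₁; inj₂)
import Data.Sum as Sum
open import Function using (_∘_; id; case_of_; Injective)
open import Function.Bundles using (Equivalence)
open import Relation.Nullary using (¬_; Dec; yes; no; contradiction)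
open import Relation.Nullary.Decidable using (⌊_⌋; T?; isYes≗does; dec-true; dec-false; toWitness; decidable-stable)
open import Relation.Binary.PropositionalEquality

⌊⌋-true : ∀ {P : Set} (d : Dec P) → P → ⌊ d ⌋ ≡ true
⌊⌋-true d p = trans (isYes≗does d) (dec-true d p)

⌊⌋-false : ∀ {P : Set} (d : Dec P) → ¬ P → ⌊ d ⌋ ≡ false
⌊⌋-false d ¬p = trans (isYes≗does d) (dec-false d ¬p)

⌊⌋-true⁻¹ : ∀ {P : Set} (d : Dec P) → ⌊ d ⌋ ≡ true → P
⌊⌋-true⁻¹ d e = toWitness (Equivalence.from T-≡ e)

xor-≢ : ∀ {a b} → T (a xor b) → a ≢ b
xor-≢ {true} {false} _ ()
xor-≢ {false} {true} _ ()

≢-xor : ∀ {a b} → a ≢ b → T (a xor b)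
≢-xor {true} {true} a≢b = a≢b refl
≢-xor {true} {false} _ = _
≢-xor {false} {true} _ = _
≢-xor {false} {false} a≢b = a≢b refl

true≢false : true ≢ false
true≢false ()

count : ∀ {n} → (Fin n → Bool) → ℕ
count {n} p = length (filterᵇ p (allFin n))

lookup-injective : ∀ {A : Set} {xs : List A} → Unique xs → ∀ {i j} → lookup xs i ≡ lookup xs j → i ≡ j
lookup-injective {xs = _ ∷ _} (_ ∷ _) {zero} {zero} _ = refl
lookup-injective {xs = _ ∷ _} (x∉xs ∷ _) {zero} {suc j} eq = contradiction eq (All.lookup x∉xs (∈-lookup j))
lookup-injective {xs = _ ∷ _} (x∉xs ∷ _) {suc i} {zero} eq = contradiction (sym eq) (All.lookup x∉xs (∈-lookup i))
lookup-injective {xs = _ ∷ _} (_ ∷ u) {suc i} {suc j} eq = cong suc (lookup-injective u eq)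

module _ {n : ℕ} (p : Fin n → Bool) where

  private
    selected : List (Fin n)
    selected = filterᵇ p (allFin n)

  injectiveOn⇒count≤ : ∀ {M} (g : Fin n → Fin M) →
    (∀ {x y} → T (p x) → T (p y) → g x ≡ g y → x ≡ y) → count p ≤ M
  injectiveOn⇒count≤ g inj =
    injective⇒≤ {f = g ∘ lookup selected}
      λ eq → lookup-injective (filter⁺ (T? ∘ p) (allFin⁺ n)) (inj (selected-p _) (selected-p _) eq)
    where
    selected-p : ∀ i → T (p (lookup selected i))
    selected-p i = proj₂ (∈-filter⁻ (T? ∘ p) {xs = allFin n} (∈-lookup i))

  injective⇒≤count : ∀ {M} (h : Fin M → Fin n) → Injective _≡_ _≡_ h → (∀ j → T (p (h j))) → M ≤ count p
  injective⇒≤count h inj ph = injective⇒≤ {f = index ∘ h∈selected} λ {i} {j} eq → inj (begin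
      h i                                 ≡⟨ lookup-index (h∈selected i) ⟩
      lookup selected (index (h∈selected i)) ≡⟨ cong (lookup selected) eq ⟩
      lookup selected (index (h∈selected j)) ≡⟨ lookup-index (h∈selected j) ⟨
      h j                                 ∎)
    where
    open ≡-Reasoning
    h∈selected : ∀ j → h j ∈ selected
    h∈selected j = ∈-filter⁺ (T? ∘ p) (∈-allFin (h j)) (ph j)

allFalse : ∀ {n} → Word n
allFalse _ = false

flipSet-allFalse : ∀ {n} (S : Subset′ n) → flipSet allFalse S ≗ S
flipSet-allFalse S x with S x
... | true = refl
... | false = refl

flipSet-changed : ∀ {n} (w : Word n) (S : Subset′ n) {x} → flipSet w S x ≢ w x → S x ≡ true
flipSet-changed w S {x} changed with S x
... | true = refl
... | false = contradiction refl changed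

flipBit-here : ∀ {n} (y : Word n) p → flipBit y p p ≡ not (y p)
flipBit-here y p = cong (λ b → if b then not (y p) else y p) (⌊⌋-true (p ≟ p) refl)

flipBit-elsewhere : ∀ {n} (y : Word n) {p q} → p ≢ q → flipBit y p q ≡ y q
flipBit-elsewhere y {p} {q} p≢q = cong (λ b → if b then not (y q) else y q) (⌊⌋-false (p ≟ q) p≢q)

hammingDistance : ∀ {m} → Word m → Word m → ℕ
hammingDistance u v = count λ q → u q xor v q

3≤hammingDistance : ∀ {m} {u v : Word m} {a b d : Fin m} → a ≢ b → a ≢ d → b ≢ d →
  u a ≢ v a → u b ≢ v b → u d ≢ v d → 3 ≤ hammingDistance u v
3≤hammingDistance {m} {u} {v} {a} {b} {d} a≢b a≢d b≢d differ-a differ-b differ-d =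
  injective⇒≤count _ pick pick-injective differs
  where
  pick : Fin 3 → Fin m
  pick zero = a
  pick (suc zero) = b
  pick (suc (suc zero)) = d

  pick-injective : Injective _≡_ _≡_ pick
  pick-injective {zero} {zero} _ = refl
  pick-injective {zero} {suc zero} eq = contradiction eq a≢b
  pick-injective {zero} {suc (suc zero)} eq = contradiction eq a≢d
  pick-injective {suc zero} {zero} eq = contradiction (sym eq) a≢b
  pick-injective {suc zero} {suc zero} _ = refl
  pick-injective {suc zero} {suc (suc zero)} eq = contradiction eq b≢d
  pick-injective {suc (suc zero)} {zero} eq = contradiction (sym eq) a≢d
  pick-injective {suc (suc zero)} {suc zero} eq = contradiction (sym eq) b≢d
  pick-injective {suc (suc zero)} {suc (suc zero)} _ = refl

  differs : ∀ j → T (u (pick j) xor v (pick j))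
  differs zero = ≢-xor differ-a
  differs (suc zero) = ≢-xor differ-b
  differs (suc (suc zero)) = ≢-xor differ-d

hammingDistance-flipBit≤2 : ∀ {m} (y : Word m) {u v : Word m} p p' →
  flipBit y p ≗ u → flipBit y p' ≗ v → hammingDistance u v ≤ 2
hammingDistance-flipBit≤2 {m} y {u} {v} p p' y^p≗u y^p'≗v =
  injectiveOn⇒count≤ _ side λ dx dy → side-injective (flipped dx) (flipped dy)
  where
  flipped : ∀ {q} → T (u q xor v q) → q ≡ p ⊎ q ≡ p'
  flipped {q} d with p ≟ q | p' ≟ q
  ... | yes p≡q | _ = inj₁ (sym p≡q)
  ... | no _ | yes p'≡q = inj₂ (sym p'≡q)
  ... | no p≢q | no p'≢q = contradiction
          (trans (sym (y^p≗u q)) (trans (flipBit-elsewhere y p≢q) (sym (trans (sym (y^p'≗v q)) (flipBit-elsewhere y p'≢q)))))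
          (xor-≢ d)

  side : Fin m → Fin 2
  side q = if ⌊ q ≟ p ⌋ then zero else suc zero

  side-here : side p ≡ zero
  side-here = cong (λ b → if b then zero else suc zero) (⌊⌋-true (p ≟ p) refl)

  side-elsewhere : ∀ {q} → q ≢ p → side q ≡ suc zero
  side-elsewhere {q} q≢p = cong (λ b → if b then zero else suc zero) (⌊⌋-false (q ≟ p) q≢p)

  side-injective : ∀ {x y} → x ≡ p ⊎ x ≡ p' → y ≡ p ⊎ y ≡ p' → side x ≡ side y → x ≡ y
  side-injective (inj₁ refl) (inj₁ refl) _ = refl
  side-injective (inj₂ refl) (inj₂ refl) _ = refl
  side-injective (inj₁ refl) (inj₂ refl) eq = decidable-stable (p ≟ p') λ p≢p' →
    contradiction (trans (sym side-here) (trans eq (side-elsewhere (p≢p' ∘ sym)))) λ ()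
  side-injective (inj₂ refl) (inj₁ refl) eq = sym (side-injective (inj₁ refl) (inj₂ refl) (sym eq))

disjoint-shared : ∀ {n k} {B : Fin k → Subset′ n} →
  (∀ a b → a ≢ b → ∀ x → B a x ≡ true → B b x ≡ false) →
  ∀ {a b x} → B a x ≡ true → B b x ≡ true → a ≡ b
disjoint-shared {B = B} disjoint {a} {b} {x} a∋x b∋x =
  decidable-stable (a ≟ b) λ a≢b → true≢false (trans (sym b∋x) (disjoint a b a≢b x a∋x))

singleton-true : ∀ {n} {p q : Fin n} → singleton p q ≡ true → p ≡ q
singleton-true {p = p} {q} = ⌊⌋-true⁻¹ (p ≟ q)

singleton-combine : ∀ {r m} (i : Fin r) (p q : Fin m) → singleton (combine i p) (combine i q) ≡ singleton p q
singleton-combine i p q with p ≟ q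
... | yes refl = ⌊⌋-true (combine i p ≟ combine i p) refl
... | no p≢q = ⌊⌋-false (combine i p ≟ combine i q) (p≢q ∘ combine-injectiveʳ i p i q)

-- The OR, over r blocks of m bits, of a detector of t fixed patterns

module OrOfPatterns {r m t : ℕ} (pat : Fin t → Word m) where

  IsPattern : Word m → Set
  IsPattern y = ∃ λ c → y ≗ pat c

  isPattern? : ∀ y → Dec (IsPattern y)
  isPattern? y = any? λ c → all? λ q → y q ≟ᵇ pat c q

  IsPattern-resp : ∀ {y z} → y ≗ z → IsPattern y → IsPattern z
  IsPattern-resp y≗z (c , y≗pat) = c , λ q → trans (sym (y≗z q)) (y≗pat q)

  blockIndex : Fin (r * m) → Fin r
  blockIndex x = proj₁ (remQuot {r} m x)

  position : Fin (r * m) → Fin m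
  position x = proj₂ (remQuot {r} m x)

  blockIndex-combine : ∀ (i : Fin r) (q : Fin m) → blockIndex (combine i q) ≡ i
  blockIndex-combine i q = cong proj₁ (remQuot-combine {k = m} i q)

  position-combine : ∀ (i : Fin r) (q : Fin m) → position (combine i q) ≡ q
  position-combine i q = cong proj₂ (remQuot-combine {k = m} i q)

  ≡-fromParts : ∀ {x y} → blockIndex x ≡ blockIndex y → position x ≡ position y → x ≡ y
  ≡-fromParts {x} {y} i≡ q≡ =
    trans (sym (combine-remQuot {r} m x)) (trans (cong₂ combine i≡ q≡) (combine-remQuot {r} m y))

  block : Word (r * m) → Fin r → Word m
  block w i q = w (combine i q)

  block-flipBit : ∀ w i p → block (flipBit w (combine i p)) i ≗ flipBit (block w i) p
  block-flipBit w i p q =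
    cong (λ b → if b then not (w (combine i q)) else w (combine i q)) (singleton-combine i p q)

  Accepts : Word (r * m) → Set
  Accepts w = ∃ λ i → IsPattern (block w i)

  accepts? : ∀ w → Dec (Accepts w)
  accepts? w = any? λ i → isPattern? (block w i)

  orOfPatterns : BoolFun (r * m)
  orOfPatterns w = ⌊ accepts? w ⌋

  rejecting≢accepting : ∀ w w' → ¬ Accepts w → Accepts w' → orOfPatterns w ≢ orOfPatterns w'
  rejecting≢accepting w w' ¬acc acc' eq =
    true≢false (trans (sym (⌊⌋-true (accepts? w') acc')) (trans (sym eq) (⌊⌋-false (accepts? w) ¬acc)))

  sensitive-at-rejecting : ∀ w w' → ¬ Accepts w → orOfPatterns w ≢ orOfPatterns w' → Accepts w'
  sensitive-at-rejecting w w' ¬acc ne = decidable-stable (accepts? w') λ ¬acc' →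
    ne (trans (⌊⌋-false (accepts? w) ¬acc) (sym (⌊⌋-false (accepts? w') ¬acc')))

  Touches : Subset′ (r * m) → Fin r → Set
  Touches S i = ∃ λ q → S (combine i q) ≡ true

  touches? : ∀ S i → Dec (Touches S i)
  touches? S i = any? λ q → S (combine i q) ≟ᵇ true

  block-flipSet-untouched : ∀ w S i → ¬ Touches S i → block (flipSet w S) i ≗ block w i
  block-flipSet-untouched w S i untouched q with S (combine i q) in eq
  ... | true = contradiction (q , eq) untouched
  ... | false = refl

  touches-accepting-block : ∀ w S {i} → IsPattern (block w i) →
    orOfPatterns w ≢ orOfPatterns (flipSet w S) → Touches S i
  touches-accepting-block w S {i} accepting sensitive = decidable-stable (touches? S i) λ untouched →
    let still-accepting = IsPattern-resp (sym ∘ block-flipSet-untouched w S i untouched) accepting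
    in sensitive (trans (⌊⌋-true (accepts? w) (i , accepting))
                        (sym (⌊⌋-true (accepts? (flipSet w S)) (i , still-accepting))))

  touches-created-pattern : ∀ w S {i} → ¬ Accepts w → IsPattern (block (flipSet w S) i) → Touches S i
  touches-created-pattern w S {i} ¬acc created = decidable-stable (touches? S i) λ untouched →
    ¬acc (i , IsPattern-resp (block-flipSet-untouched w S i untouched) created)

  touches-singleton : ∀ {x i} → Touches (singleton x) i → ∃ λ q → x ≡ combine i q
  touches-singleton (q , hit) = q , singleton-true hit

  sensAt-accepting≤ : ∀ w → Accepts w → sensAt orOfPatterns w ≤ m
  sensAt-accepting≤ w (i , accepting) =
    injectiveOn⇒count≤ _ position λ sx sy → ≡-fromParts (trans (in-block sx) (sym (in-block sy)))
    where
    in-block : ∀ {x} → T (orOfPatterns w xor orOfPatterns (flipBit w x)) → blockIndex x ≡ i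
    in-block {x} s with q , refl ← touches-singleton {x} {i} (touches-accepting-block w (singleton x) accepting (xor-≢ s)) =
      blockIndex-combine i q

  sensitive-bit-at-rejecting : ∀ w x → ¬ Accepts w → orOfPatterns w ≢ orOfPatterns (flipBit w x) →
    IsPattern (flipBit (block w (blockIndex x)) (position x))
  sensitive-bit-at-rejecting w x ¬acc sensitive
    with j , created ← sensitive-at-rejecting w (flipBit w x) ¬acc sensitive
    with q , refl ← touches-singleton {x} {j} (touches-created-pattern w (singleton x) ¬acc created)
    = subst₂ (λ i p → IsPattern (flipBit (block w i) p)) (sym (blockIndex-combine j q)) (sym (position-combine j q))
        (IsPattern-resp (block-flipBit w j q) created)

  blocks-accepting≤ : ∀ w {k} → Accepts w → SensitiveBlocks orOfPatterns w k → k ≤ m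
  blocks-accepting≤ w {k} (i , accepting) (B , disjoint , sensitive) =
    injective⇒≤ {f = hit} λ {a} {b} eq →
      disjoint-shared {B = B} disjoint (proj₂ (touched a)) (subst (λ q → B b (combine i q) ≡ true) (sym eq) (proj₂ (touched b)))
    where
    touched : ∀ a → Touches (B a) i
    touched a = touches-accepting-block w (B a) accepting (sensitive a)
    hit : Fin k → Fin m
    hit a = proj₁ (touched a)

  blocks-rejecting≤ : ∀ w {k} → ¬ Accepts w → SensitiveBlocks orOfPatterns w k → k ≤ r * t
  blocks-rejecting≤ w {k} ¬acc (B , disjoint , sensitive) = injective⇒≤ {f = code} code-injective
    where
    created : ∀ a → Accepts (flipSet w (B a))
    created a = sensitive-at-rejecting w (flipSet w (B a)) ¬acc (sensitive a)

    code : Fin k → Fin (r * t)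
    code a = combine (proj₁ (created a)) (proj₁ (proj₂ (created a)))

    -- Some position of block i disagrees with pattern c in w, and every B a
    -- creating pattern c in block i must flip it.
    code-injective : Injective _≡_ _≡_ code
    code-injective {a} {b} eq
      with created a | created b
         | combine-injective (proj₁ (created a)) (proj₁ (proj₂ (created a)))
                             (proj₁ (created b)) (proj₁ (proj₂ (created b))) eq
    ... | i , c , a-creates | .i , .c , b-creates | refl , refl
      with q , disagrees ← ¬∀⟶∃¬ m _ (λ q → block w i q ≟ᵇ pat c q) (λ agree → ¬acc (i , c , agree))
      = disjoint-shared {B = B} disjoint (flipped (B a) a-creates) (flipped (B b) b-creates)
      where
      flipped : ∀ S → block (flipSet w S) i ≗ pat c → S (combine i q) ≡ true
      flipped S creates = flipSet-changed w S λ unchanged → disagrees (trans (sym unchanged) (creates q))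

  blocks≤ : ∀ w {k} → SensitiveBlocks orOfPatterns w k → k ≤ m ⊔ r * t
  blocks≤ w blocks = case accepts? w of λ where
    (yes acc) → ≤-trans (blocks-accepting≤ w acc blocks) (m≤m⊔n m (r * t))
    (no ¬acc) → ≤-trans (blocks-rejecting≤ w ¬acc blocks) (m≤n⊔m m (r * t))

  module _ (separated : ∀ {c c'} → c ≢ c' → 3 ≤ hammingDistance (pat c) (pat c')) where

    neighbouring-patterns : ∀ y {p p'} → IsPattern (flipBit y p) → IsPattern (flipBit y p') → p ≡ p'
    neighbouring-patterns y {p} {p'} (c , y^p≗c) (c' , y^p'≗c') = decidable-stable (p ≟ p') λ p≢p' →
      ≤⇒≯ (hammingDistance-flipBit≤2 y p p' y^p≗c y^p'≗c') (separated (c≢c' p≢p'))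
      where
      c≢c' : p ≢ p' → c ≢ c'
      c≢c' p≢p' refl = not-¬ refl (begin
        y p              ≡⟨ flipBit-elsewhere y (p≢p' ∘ sym) ⟨
        flipBit y p' p   ≡⟨ y^p'≗c' p ⟩
        pat c p          ≡⟨ y^p≗c p ⟨
        flipBit y p p    ≡⟨ flipBit-here y p ⟩
        not (y p)        ∎)
        where open ≡-Reasoning

    sensAt-rejecting≤ : ∀ w → ¬ Accepts w → sensAt orOfPatterns w ≤ r
    sensAt-rejecting≤ w ¬acc =
      injectiveOn⇒count≤ _ blockIndex λ {x} {y} sx sy eq → ≡-fromParts eq
        (neighbouring-patterns (block w (blockIndex x))
          (created sx) (subst (λ i → IsPattern (flipBit (block w i) (position y))) (sym eq) (created sy)))
      where
      created : ∀ {x} → T (orOfPatterns w xor orOfPatterns (flipBit w x)) →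
        IsPattern (flipBit (block w (blockIndex x)) (position x))
      created {x} s = sensitive-bit-at-rejecting w x ¬acc (xor-≢ s)

    sensAt≤ : ∀ w → sensAt orOfPatterns w ≤ m ⊔ r
    sensAt≤ w = case accepts? w of λ where
      (yes acc) → ≤-trans (sensAt-accepting≤ w acc) (m≤m⊔n m r)
      (no ¬acc) → ≤-trans (sensAt-rejecting≤ w ¬acc) (m≤n⊔m m r)

  module _ (nonempty : ∀ c → ∃ λ q → pat c q ≡ true) where

    allFalse-rejected : ¬ Accepts allFalse
    allFalse-rejected (_ , c , allFalse≗c) = let q , c∋q = nonempty c in true≢false (trans (sym c∋q) (sym (allFalse≗c q)))

    r≤sensAt-allFalse : ∀ {c₀ p₀} → pat c₀ ≗ singleton p₀ → r ≤ sensAt orOfPatterns allFalse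
    r≤sensAt-allFalse {c₀} {p₀} c₀≗p₀ =
      injective⇒≤count _ (λ i → combine i p₀) (λ {i} {j} → combine-injectiveˡ i p₀ j p₀) λ i →
        ≢-xor (rejecting≢accepting allFalse (flipBit allFalse (combine i p₀)) allFalse-rejected (i , c₀ , λ q → begin
          block (flipBit allFalse (combine i p₀)) i q ≡⟨ block-flipBit allFalse i p₀ q ⟩
          flipBit allFalse p₀ q                      ≡⟨ flipSet-allFalse (singleton p₀) q ⟩
          singleton p₀ q                             ≡⟨ c₀≗p₀ q ⟨
          pat c₀ q                                   ∎))
      where open ≡-Reasoning

    patternBlock : Fin (r * t) → Subset′ (r * m)
    patternBlock ic x = ⌊ blockIndex x ≟ proj₁ (remQuot {r} t ic) ⌋ ∧ pat (proj₂ (remQuot {r} t ic)) (position x)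

    patternBlock-∋ : ∀ ic {x} → patternBlock ic x ≡ true →
      blockIndex x ≡ proj₁ (remQuot {r} t ic) × pat (proj₂ (remQuot {r} t ic)) (position x) ≡ true
    patternBlock-∋ ic {x} ∋x with blockIndex x ≟ proj₁ (remQuot {r} t ic)
    ... | yes i≡ = i≡ , ∋x

    patternBlock-block : ∀ ic → block (patternBlock ic) (proj₁ (remQuot {r} t ic)) ≗ pat (proj₂ (remQuot {r} t ic))
    patternBlock-block ic q = begin
      ⌊ blockIndex (combine i q) ≟ i ⌋ ∧ pat c (position (combine i q))
        ≡⟨ cong₂ (λ j p → ⌊ j ≟ i ⌋ ∧ pat c p) (blockIndex-combine i q) (position-combine i q) ⟩
      ⌊ i ≟ i ⌋ ∧ pat c q
        ≡⟨ cong (_∧ pat c q) (⌊⌋-true (i ≟ i) refl) ⟩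
      pat c q ∎
      where
      open ≡-Reasoning
      i : Fin r
      i = proj₁ (remQuot {r} t ic)
      c : Fin t
      c = proj₂ (remQuot {r} t ic)

    patternBlocks-sensitive : (∀ {c c' q} → pat c q ≡ true → pat c' q ≡ true → c ≡ c') →
      SensitiveBlocks orOfPatterns allFalse (r * t)
    patternBlocks-sensitive disjointSupports = patternBlock , disjoint , sensitive
      where
      remQuot-injective : ∀ {a b} → remQuot {r} t a ≡ remQuot t b → a ≡ b
      remQuot-injective {a} {b} eq =
        trans (sym (combine-remQuot {r} t a)) (trans (cong (uncurry combine) eq) (combine-remQuot {r} t b))

      shared : ∀ {a b x} → patternBlock a x ≡ true → patternBlock b x ≡ true → a ≡ b
      shared {a} {b} a∋x b∋x with patternBlock-∋ a a∋x | patternBlock-∋ b b∋x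
      ... | i≡ , c∋ | i≡' , c'∋ = remQuot-injective (cong₂ _,_ (trans (sym i≡) i≡') (disjointSupports c∋ c'∋))

      disjoint : ∀ a b → a ≢ b → ∀ x → patternBlock a x ≡ true → patternBlock b x ≡ false
      disjoint a b a≢b x a∋x = ¬-not λ b∋x → a≢b (shared a∋x b∋x)

      sensitive : ∀ ic → orOfPatterns allFalse ≢ orOfPatterns (flipSet allFalse (patternBlock ic))
      sensitive ic = rejecting≢accepting allFalse (flipSet allFalse (patternBlock ic)) allFalse-rejected
        (proj₁ (remQuot {r} t ic) , proj₂ (remQuot {r} t ic) , λ q →
          trans (flipSet-allFalse (patternBlock ic) (combine (proj₁ (remQuot {r} t ic)) q)) (patternBlock-block ic q))

-- Positions 2k+1 = pairs (2 × k) plus one loner; classes k+1 = k pairs plus the loner's class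

module PairsAndLoner (k : ℕ) where

  Position : Set
  Position = Fin (2 * k + 1)

  Class : Set
  Class = Fin (k + 1)

  pairMember : Fin 2 → Fin k → Position
  pairMember h j = combine h j ↑ˡ 1

  loner : Position
  loner = (2 * k) ↑ʳ zero

  pairClass : Fin k → Class
  pairClass j = j ↑ˡ 1

  lonerClass : Class
  lonerClass = k ↑ʳ zero

  classOfSplit : Fin (2 * k) ⊎ Fin 1 → Class
  classOfSplit = join k 1 ∘ Sum.map (proj₂ ∘ remQuot {2} k) id

  classOf : Position → Class
  classOf = classOfSplit ∘ splitAt (2 * k)

  classIndicator : Class → Word (2 * k + 1)
  classIndicator c p = ⌊ classOf p ≟ c ⌋

  classOf-pairMember : ∀ h j → classOf (pairMember h j) ≡ pairClass j
  classOf-pairMember h j =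
    trans (cong classOfSplit (splitAt-↑ˡ (2 * k) (combine h j) 1)) (cong ((_↑ˡ 1) ∘ proj₂) (remQuot-combine h j))

  classOf-loner : classOf loner ≡ lonerClass
  classOf-loner = cong classOfSplit (splitAt-↑ʳ (2 * k) 1 zero)

  pairClass≢lonerClass : ∀ j → pairClass j ≢ lonerClass
  pairClass≢lonerClass j eq with trans (sym (splitAt-↑ˡ k j 1)) (trans (cong (splitAt k) eq) (splitAt-↑ʳ k 1 zero))
  ... | ()

  pairMembers-distinct : ∀ j → pairMember zero j ≢ pairMember (suc zero) j
  pairMembers-distinct j eq with combine-injectiveˡ (zero {1}) j (suc zero) j (↑ˡ-injective 1 _ _ eq)
  ... | ()

  classOf≡lonerClass : ∀ p → classOf p ≡ lonerClass → p ≡ loner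
  classOf≡lonerClass p eq with splitAt (2 * k) p in split
  ... | inj₁ r = contradiction eq (pairClass≢lonerClass _)
  ... | inj₂ zero = trans (sym (join-splitAt (2 * k) 1 p)) (cong (join (2 * k) 1) split)

  data ClassView : Class → Set where
    pair : ∀ j → ClassView (pairClass j)
    lone : ClassView lonerClass

  classView : ∀ c → ClassView c
  classView c with splitAt k c in split
  ... | inj₁ j = subst ClassView (trans (cong (join k 1) (sym split)) (join-splitAt k 1 c)) (pair j)
  ... | inj₂ zero = subst ClassView (trans (cong (join k 1) (sym split)) (join-splitAt k 1 c)) lone

  member : ∀ c → ∃ λ p → classOf p ≡ c
  member c with classView c
  ... | pair j = pairMember zero j , classOf-pairMember zero j
  ... | lone = loner , classOf-loner

  classIndicator-nonempty : ∀ c → ∃ λ p → classIndicator c p ≡ true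
  classIndicator-nonempty c = let p , p∈c = member c in p , ⌊⌋-true (classOf p ≟ c) p∈c

  classIndicator-disjoint : ∀ {c c' p} → classIndicator c p ≡ true → classIndicator c' p ≡ true → c ≡ c'
  classIndicator-disjoint {c} {c'} {p} p∈c p∈c' =
    trans (sym (⌊⌋-true⁻¹ (classOf p ≟ c) p∈c)) (⌊⌋-true⁻¹ (classOf p ≟ c') p∈c')

  classIndicator-loner : classIndicator lonerClass ≗ singleton loner
  classIndicator-loner p with loner ≟ p
  ... | yes refl = ⌊⌋-true (classOf loner ≟ lonerClass) classOf-loner
  ... | no loner≢p = ⌊⌋-false (classOf p ≟ lonerClass) (loner≢p ∘ sym ∘ classOf≡lonerClass p)

  different-classes : ∀ {p p' c c'} → classOf p ≡ c → classOf p' ≡ c' → c ≢ c' → p ≢ p'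
  different-classes p∈c p'∈c' c≢c' refl = c≢c' (trans (sym p∈c) p'∈c')

  differs : ∀ {p c c'} → classOf p ≡ c → c ≢ c' → classIndicator c p ≢ classIndicator c' p
  differs {p} {c} {c'} p∈c c≢c' eq =
    true≢false (trans (sym (⌊⌋-true (classOf p ≟ c) p∈c)) (trans eq (⌊⌋-false (classOf p ≟ c') (c≢c' ∘ trans (sym p∈c)))))

  differs' : ∀ {p c c'} → classOf p ≡ c' → c ≢ c' → classIndicator c p ≢ classIndicator c' p
  differs' p∈c' c≢c' = differs p∈c' (c≢c' ∘ sym) ∘ sym

  -- A pair class and any other class already differ on three positions.
  classIndicator-separated : ∀ {c c'} → c ≢ c' → 3 ≤ hammingDistance (classIndicator c) (classIndicator c')
  classIndicator-separated {c} {c'} c≢c' with classView c | classView c'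
  ... | pair j | _ =
    let d , d∈c' = member c' ; a∈c = classOf-pairMember zero j ; b∈c = classOf-pairMember (suc zero) j in
    3≤hammingDistance {u = classIndicator c} {classIndicator c'} (pairMembers-distinct j)
      (different-classes a∈c d∈c' c≢c') (different-classes b∈c d∈c' c≢c')
      (differs a∈c c≢c') (differs b∈c c≢c') (differs' d∈c' c≢c')
  ... | lone | pair j =
    let a∈c' = classOf-pairMember zero j ; b∈c' = classOf-pairMember (suc zero) j in
    3≤hammingDistance {u = classIndicator c} {classIndicator c'} (pairMembers-distinct j)
      (different-classes a∈c' classOf-loner (c≢c' ∘ sym)) (different-classes b∈c' classOf-loner (c≢c' ∘ sym))
      (differs' a∈c' c≢c') (differs' b∈c' c≢c') (differs classOf-loner c≢c')
  ... | lone | lone = contradiction refl c≢c'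

theorem2 : (k : ℕ) →
    Σ (BoolFun ((2 * k + 1) * (2 * k + 1))) λ f →
      SensitivityIs f (2 * k + 1) × BlockSensitivityIs f ((2 * k + 1) * (k + 1))
theorem2 k = orOfPatterns , (sensitivity , sensAt≤m) , ((allFalse , blocks) , blocks≤m[k+1])
  where
  open PairsAndLoner k
  open OrOfPatterns {2 * k + 1} classIndicator

  m : ℕ
  m = 2 * k + 1

  sensAt≤m : ∀ w → sensAt orOfPatterns w ≤ m
  sensAt≤m w = subst (sensAt orOfPatterns w ≤_) (⊔-idem m) (sensAt≤ classIndicator-separated w)

  sensitivity : ∃ λ w → sensAt orOfPatterns w ≡ m
  sensitivity = allFalse , ≤-antisym (sensAt≤m allFalse) (r≤sensAt-allFalse classIndicator-nonempty classIndicator-loner)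

  blocks : SensitiveBlocks orOfPatterns allFalse (m * (k + 1))
  blocks = patternBlocks-sensitive classIndicator-nonempty classIndicator-disjoint

  blocks≤m[k+1] : ∀ w k′ → SensitiveBlocks orOfPatterns w k′ → k′ ≤ m * (k + 1)
  blocks≤m[k+1] w k′ bs = subst (k′ ≤_) (m≤n⇒m⊔n≡n (subst (λ n → m ≤ m * n) (+-comm 1 k) (m≤m*n m (1 + k)))) (blocks≤ w bs)
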